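{- The $K$-orbits $\Sigma_{6}$, $\Sigma_{12}$ and $\Sigma_{13}$ are distinct.
   Context: $q$ is odd; $\varepsilon$ is a non-square in $\mathbb{F}_q$. Points of $\mathrm{PG}(5,q)$ are represented by symmetric $3\times3$ matrices over $\mathbb{F}_q$ (up to scalars); the rank-1 points form the quadric Veronesean $\mathcal{V}(\mathbb{F}_q)$. $K=\mathrm{PGL}(3,q)$ acts on these points (and hence on planes) via $M\mapsto AMA^T$. With $(\alpha,\beta,\gamma)$ ranging over nonzero vectors: $\Sigma_6$ is the $K$-orbit of the plane $\{\begin{pmatrix}\alpha&\beta&0\\ \beta&\varepsilon\alpha&0\\ 0&0&\gamma\end{pmatrix}\}$, $\Sigma_{12}$ the $K$-orbit of $\{\begin{pmatrix}\alpha&\beta&0\\ \beta&\gamma&\beta\\ 0&\beta&\gamma\end{pmatrix}\}$, and $\Sigma_{13}$ the $K$-orbit of $\{\begin{pmatrix}\alpha&\beta&0\\ \beta&\gamma&\beta\\ 0&\beta&\varepsilon\gamma\end{pmatrix}\}$. -}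

module Defs where

open import Level using (Level; _⊔_) renaming (suc to lsuc)
open import Algebra.Bundles using (CommutativeRing)
open import Data.Nat using (ℕ)
open import Data.Fin using (Fin; zero; suc)
open import Data.Product using (Σ; ∃; _×_; _,_)
open import Relation.Nullary using (¬_)
open import Relation.Binary using (Decidable)

-- A finite field of odd order (= characteristic ≠ 2), as a commutative ring
-- with decidable equality, 1 ≉ 0, inverses of nonzero elements, and a
-- surjective enumeration by some Fin n.
record FiniteOddField (c ℓ : Level) : Set (lsuc (c ⊔ ℓ)) where
  field
    commRing : CommutativeRing c ℓ
  open CommutativeRing commRing public
  field
    _≟_      : Decidable _≈_
    1≉0      : ¬ (1# ≈ 0#)
    inverse  : ∀ x → ¬ (x ≈ 0#) → Σ Carrier (λ y → x * y ≈ 1#)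
    size     : ℕ
    enum     : Fin size → Carrier
    enum-surj : ∀ x → Σ (Fin size) (λ i → enum i ≈ x)
    odd      : ¬ (1# + 1# ≈ 0#)

module _ {c ℓ : Level} (F : FiniteOddField c ℓ) where
  open FiniteOddField F using (Carrier; _≈_; _+_; _*_; 0#; 1#)

  IsSquare : Carrier → Set (c ⊔ ℓ)
  IsSquare x = Σ Carrier (λ y → y * y ≈ x)

  Mat : Set c
  Mat = Fin 3 → Fin 3 → Carrier

  _≈M_ : Mat → Mat → Set ℓ
  M ≈M N = ∀ i j → M i j ≈ N i j

  sum3 : (Fin 3 → Carrier) → Carrier
  sum3 f = f zero + (f (suc zero) + f (suc (suc zero)))

  _·_ : Mat → Mat → Mat
  (M · N) i j = sum3 (λ k → M i k * N k j)

  transpose : Mat → Mat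
  transpose M i j = M j i

  idM : Mat
  idM zero zero = 1#
  idM (suc (suc zero)) (suc (suc zero)) = 1#
  idM (suc zero) (suc zero) = 1#
  idM _ _ = 0#

  Invertible : Mat → Set (c ⊔ ℓ)
  Invertible A = Σ Mat (λ B → ((A · B) ≈M idM) × ((B · A) ≈M idM))

  act : Mat → Mat → Mat
  act A M = (A · M) · transpose A

  mk : Carrier → Carrier → Carrier → Carrier → Carrier → Carrier →
       Carrier → Carrier → Carrier → Mat
  mk a b c' d e f g h k zero zero = a
  mk a b c' d e f g h k zero (suc zero) = b
  mk a b c' d e f g h k zero (suc (suc zero)) = c'
  mk a b c' d e f g h k (suc zero) zero = d
  mk a b c' d e f g h k (suc zero) (suc zero) = e
  mk a b c' d e f g h k (suc zero) (suc (suc zero)) = f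
  mk a b c' d e f g h k (suc (suc zero)) zero = g
  mk a b c' d e f g h k (suc (suc zero)) (suc zero) = h
  mk a b c' d e f g h k (suc (suc zero)) (suc (suc zero)) = k

  -- A plane of PG(5,q), given as the (vector-space) set of symmetric
  -- matrices it consists of (membership predicate on matrices).
  Plane : Set (lsuc (c ⊔ ℓ))
  Plane = Mat → Set (c ⊔ ℓ)

  -- representative of Σ₆ (ε the fixed non-square)
  Π₆ : Carrier → Plane
  Π₆ ε N = Σ Carrier λ α → Σ Carrier λ β → Σ Carrier λ γ →
           N ≈M mk α β 0# β (ε * α) 0# 0# 0# γ

  Π₁₂ : Plane
  Π₁₂ N = Σ Carrier λ α → Σ Carrier λ β → Σ Carrier λ γ →
          N ≈M mk α β 0# β γ β 0# β γ

  Π₁₃ : Carrier → Plane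
  Π₁₃ ε N = Σ Carrier λ α → Σ Carrier λ β → Σ Carrier λ γ →
            N ≈M mk α β 0# β γ β 0# β (ε * γ)

  MapsOnto : Mat → Plane → Plane → Set (c ⊔ ℓ)
  MapsOnto A P P' =
    (∀ M → P M → P' (act A M)) ×
    (∀ N → P' N → Σ Mat (λ M → P M × (act A M ≈M N)))

  SameOrbit : Plane → Plane → Set (c ⊔ ℓ)
  SameOrbit P P' = Σ Mat (λ A → Invertible A × MapsOnto A P P')

-- Two properties of a plane of symmetric matrices are invariant under
-- M ↦ A M Aᵀ, reading a vector w as a point (transforming by A⁻ᵀ) and M w as
-- its polar line with respect to the conic M (transforming by A).
--
-- (1) Some point w ≠ 0 has the same polar line with respect to every member
-- of the plane.  For Π₆ this is e₃ = (0,0,1); for Π₁₂ and Π₁₃ the 2×2 minors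
-- of the polars of w under E₁₁, E₂₂ + δE₃₃ and J force w = 0.
--
-- (2) Some member N has a point w on its conic whose tangent line u = N w is
-- nonzero and has u uᵀ in the plane.  For Π₁₂ take N = M(0,1,1), w = (0,1,-1).
-- In Π₁₃ a rank-one member u uᵀ has u₂² = ε u₁², so u = (u₀,0,0); then
-- w₀ u₀ = wᵀ N w = 0, and w₀ = 0 also gives u₀ = 0 (see nonsquare-kernel).
--
-- Π₆ has (1) but Π₁₂ and Π₁₃ do not; Π₁₂ has (2) but Π₁₃ does not.

module Submission where

open import Defs
open import Level using (Level; _⊔_)
open import Data.Fin using (Fin; zero; suc)
open import Data.Product using (Σ; _×_; _,_)
open import Data.Sum using (_⊎_; inj₁; inj₂)
open import Relation.Nullary using (¬_; yes; no; contradiction)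
open import Relation.Binary using (Setoid)
open import Relation.Binary.Definitions using (_Respects_)
import Data.Vec.Functional.Relation.Binary.Pointwise.Properties as Pointwise

module _ {c ℓ : Level} (F : FiniteOddField c ℓ) where
  open FiniteOddField F hiding (zero)
  open import Algebra.Solver.Ring.NaturalCoefficients.Default commutativeSemiring
  open import Relation.Binary.Reasoning.Setoid setoid

  x≈0⇒x*y≈0 : ∀ {x} y → x ≈ 0# → x * y ≈ 0#
  x≈0⇒x*y≈0 y x≈0 = trans (*-congʳ x≈0) (zeroˡ y)

  y≈0⇒x*y≈0 : ∀ x {y} → y ≈ 0# → x * y ≈ 0#
  y≈0⇒x*y≈0 x y≈0 = trans (*-congˡ y≈0) (zeroʳ x)

  *-cancelʳ : ∀ {w x y} → ¬ w ≈ 0# → x * w ≈ y * w → x ≈ y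
  *-cancelʳ {w} {x} {y} w≉0 xw≈yw with inverse w w≉0
  ... | w⁻¹ , w*w⁻¹≈1 = begin
    x              ≈⟨ *-identityʳ x ⟨
    x * 1#         ≈⟨ *-congˡ w*w⁻¹≈1 ⟨
    x * (w * w⁻¹)  ≈⟨ *-assoc x w w⁻¹ ⟨
    (x * w) * w⁻¹  ≈⟨ *-congʳ xw≈yw ⟩
    (y * w) * w⁻¹  ≈⟨ *-assoc y w w⁻¹ ⟩
    y * (w * w⁻¹)  ≈⟨ *-congˡ w*w⁻¹≈1 ⟩
    y * 1#         ≈⟨ *-identityʳ y ⟩
    y              ∎

  x*y≈0⇒x≈0⊎y≈0 : ∀ x y → x * y ≈ 0# → x ≈ 0# ⊎ y ≈ 0#
  x*y≈0⇒x≈0⊎y≈0 x y xy≈0 with y ≟ 0#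
  ... | yes y≈0 = inj₂ y≈0
  ... | no y≉0  = inj₁ (*-cancelʳ y≉0 (trans xy≈0 (sym (zeroˡ y))))

  x≉0⇒x*y≈0⇒y≈0 : ∀ {x y} → ¬ x ≈ 0# → x * y ≈ 0# → y ≈ 0#
  x≉0⇒x*y≈0⇒y≈0 {x} {y} x≉0 xy≈0 with x*y≈0⇒x≈0⊎y≈0 x y xy≈0
  ... | inj₁ x≈0 = contradiction x≈0 x≉0
  ... | inj₂ y≈0 = y≈0

  x*x≈0⇒x≈0 : ∀ {x} → x * x ≈ 0# → x ≈ 0#
  x*x≈0⇒x≈0 {x} xx≈0 with x*y≈0⇒x≈0⊎y≈0 x x xx≈0
  ... | inj₁ x≈0 = x≈0
  ... | inj₂ x≈0 = x≈0

  module _ {ε : Carrier} (ε-nonsquare : ¬ IsSquare F ε) where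

    nonsquare⇒≉0 : ¬ ε ≈ 0#
    nonsquare⇒≉0 ε≈0 = ε-nonsquare (0# , trans (zeroˡ 0#) (sym ε≈0))

    x*x≈ε*y*y⇒y≈0 : ∀ {x y} → x * x ≈ ε * (y * y) → y ≈ 0#
    x*x≈ε*y*y⇒y≈0 {x} {y} xx≈εyy with y ≟ 0#
    ... | yes y≈0 = y≈0
    ... | no y≉0 with inverse y y≉0
    ... | y⁻¹ , y*y⁻¹≈1 = contradiction (x * y⁻¹ , x/y-squared) ε-nonsquare
      where
      x/y-squared : (x * y⁻¹) * (x * y⁻¹) ≈ ε
      x/y-squared = begin
        (x * y⁻¹) * (x * y⁻¹)    ≈⟨ solve 2 (λ x i → (x :* i) :* (x :* i) := (x :* x) :* (i :* i)) refl x y⁻¹ ⟩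
        (x * x) * (y⁻¹ * y⁻¹)    ≈⟨ *-congʳ xx≈εyy ⟩
        ε * (y * y) * (y⁻¹ * y⁻¹) ≈⟨ solve 3 (λ e y i → e :* (y :* y) :* (i :* i) := e :* ((y :* i) :* (y :* i))) refl ε y y⁻¹ ⟩
        ε * ((y * y⁻¹) * (y * y⁻¹)) ≈⟨ *-congˡ (*-cong y*y⁻¹≈1 y*y⁻¹≈1) ⟩
        ε * (1# * 1#)            ≈⟨ *-congˡ (*-identityˡ 1#) ⟩
        ε * 1#                   ≈⟨ *-identityʳ ε ⟩
        ε                        ∎

    x*x≈ε*y*y⇒x≈0 : ∀ {x y} → x * x ≈ ε * (y * y) → x ≈ 0#
    x*x≈ε*y*y⇒x≈0 {x} {y} xx≈εyy =
      x*x≈0⇒x≈0 (trans xx≈εyy (y≈0⇒x*y≈0 ε (x≈0⇒x*y≈0 y (x*x≈ε*y*y⇒y≈0 xx≈εyy))))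

    -- (x, y) is in the kernel of [[γ, β], [β, εγ]], whose determinant εγ² − β²
    -- vanishes only when β = γ = 0.
    nonsquare-kernel : ∀ {β γ x y} → γ * x + β * y ≈ 0# → β * x + (ε * γ) * y ≈ 0# → β * x ≈ 0#
    nonsquare-kernel {β} {γ} {x} {y} row₁ row₂ with x ≟ 0#
    ... | yes x≈0 = y≈0⇒x*y≈0 β x≈0
    ... | no x≉0  = x≈0⇒x*y≈0 x (x*x≈ε*y*y⇒x≈0 (sym (*-cancelʳ x≉0 εγ²x≈β²x)))
      where
      εγ²x≈β²x : (ε * (γ * γ)) * x ≈ (β * β) * x
      εγ²x≈β²x = begin
        (ε * (γ * γ)) * x
          ≈⟨ solve 4 (λ b e g x → (e :* (g :* g)) :* x := b :* con 0 :+ (e :* (g :* g)) :* x) refl β ε γ x ⟩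
        β * 0# + (ε * (γ * γ)) * x
          ≈⟨ +-congʳ (*-congˡ row₂) ⟨
        β * (β * x + (ε * γ) * y) + (ε * (γ * γ)) * x
          ≈⟨ solve 5 (λ b e g x y → b :* (b :* x :+ (e :* g) :* y) :+ (e :* (g :* g)) :* x
                                   := (b :* b) :* x :+ (e :* g) :* (g :* x :+ b :* y)) refl β ε γ x y ⟩
        (β * β) * x + (ε * γ) * (γ * x + β * y)
          ≈⟨ +-congˡ (*-congˡ row₁) ⟩
        (β * β) * x + (ε * γ) * 0#
          ≈⟨ solve 4 (λ b e g x → (b :* b) :* x :+ (e :* g) :* con 0 := (b :* b) :* x) refl β ε γ x ⟩
        (β * β) * x
          ∎

  Vec3 : Set c
  Vec3 = Fin 3 → Carrier

  vecSetoid : Setoid c ℓ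
  vecSetoid = Pointwise.setoid setoid 3

  matSetoid : Setoid c ℓ
  matSetoid = Pointwise.setoid vecSetoid 3

  open Setoid vecSetoid using ()
    renaming (_≈_ to _≈ᵥ_; refl to ≈ᵥ-refl; sym to ≈ᵥ-sym; trans to ≈ᵥ-trans)
  open Setoid matSetoid using ()
    renaming (_≈_ to _≈ₘ_; refl to ≈ₘ-refl; sym to ≈ₘ-sym; trans to ≈ₘ-trans)

  pattern i₀ = zero
  pattern i₁ = suc zero
  pattern i₂ = suc (suc zero)

  vec3 : Carrier → Carrier → Carrier → Vec3
  vec3 x y z i₀ = x
  vec3 x y z i₁ = y
  vec3 x y z i₂ = z

  0ᵥ : Vec3
  0ᵥ _ = 0#

  NonZero : Vec3 → Set ℓ
  NonZero u = ¬ (u ≈ᵥ 0ᵥ)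

  infixr 7 _*ₛ_ _*ᵥ_
  infixl 8 _∙_
  infix 9 _ᵀ

  _*ₛ_ : Carrier → Vec3 → Vec3
  (l *ₛ u) i = l * u i

  _*ᵥ_ : Mat F → Vec3 → Vec3
  (M *ᵥ v) i = sum3 F (λ k → M i k * v k)

  dot : Vec3 → Vec3 → Carrier
  dot w u = sum3 F (λ k → w k * u k)

  outer : Vec3 → Mat F
  outer u i j = u i * u j

  _∙_ : Mat F → Mat F → Mat F
  _∙_ = _·_ F

  _ᵀ : Mat F → Mat F
  _ᵀ = transpose F

  sum3-cong : ∀ {a b c′ a′ b′ c″} → a ≈ a′ → b ≈ b′ → c′ ≈ c″ →
              a + (b + c′) ≈ a′ + (b′ + c″)
  sum3-cong a≈ b≈ c≈ = +-cong a≈ (+-cong b≈ c≈)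

  *ᵥ-cong : ∀ {M N u v} → M ≈ₘ N → u ≈ᵥ v → M *ᵥ u ≈ᵥ N *ᵥ v
  *ᵥ-cong M≈N u≈v i = sum3-cong (*-cong (M≈N i _) (u≈v _)) (*-cong (M≈N i _) (u≈v _))
                                (*-cong (M≈N i _) (u≈v _))

  *ᵥ-congˡ : ∀ M {u v} → u ≈ᵥ v → M *ᵥ u ≈ᵥ M *ᵥ v
  *ᵥ-congˡ M = *ᵥ-cong {M} ≈ₘ-refl

  *ᵥ-congʳ : ∀ {M N} → M ≈ₘ N → ∀ u → M *ᵥ u ≈ᵥ N *ᵥ u
  *ᵥ-congʳ M≈N u = *ᵥ-cong M≈N (≈ᵥ-refl {u})

  dot-cong : ∀ {w w′ u v} → w ≈ᵥ w′ → u ≈ᵥ v → dot w u ≈ dot w′ v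
  dot-cong w≈w′ u≈v = sum3-cong (*-cong (w≈w′ _) (u≈v _)) (*-cong (w≈w′ _) (u≈v _))
                                (*-cong (w≈w′ _) (u≈v _))

  dot-congʳ : ∀ w {u v} → u ≈ᵥ v → dot w u ≈ dot w v
  dot-congʳ w = dot-cong (≈ᵥ-refl {w})

  outer-cong : ∀ {u v} → u ≈ᵥ v → outer u ≈ₘ outer v
  outer-cong u≈v i j = *-cong (u≈v i) (u≈v j)

  ᵀ-cong : ∀ {A B} → A ≈ₘ B → A ᵀ ≈ₘ B ᵀ
  ᵀ-cong A≈B i j = A≈B j i

  ∙-*ᵥ-assoc : ∀ X Y v → (X ∙ Y) *ᵥ v ≈ᵥ X *ᵥ (Y *ᵥ v)
  ∙-*ᵥ-assoc X Y v i = solve 15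
    (λ x₀ x₁ x₂ y₀₀ y₀₁ y₀₂ y₁₀ y₁₁ y₁₂ y₂₀ y₂₁ y₂₂ v₀ v₁ v₂ →
         (x₀ :* y₀₀ :+ (x₁ :* y₁₀ :+ x₂ :* y₂₀)) :* v₀
      :+ ((x₀ :* y₀₁ :+ (x₁ :* y₁₁ :+ x₂ :* y₂₁)) :* v₁
      :+  (x₀ :* y₀₂ :+ (x₁ :* y₁₂ :+ x₂ :* y₂₂)) :* v₂)
      :=   x₀ :* (y₀₀ :* v₀ :+ (y₀₁ :* v₁ :+ y₀₂ :* v₂))
      :+ (x₁ :* (y₁₀ :* v₀ :+ (y₁₁ :* v₁ :+ y₁₂ :* v₂))
      :+  x₂ :* (y₂₀ :* v₀ :+ (y₂₁ :* v₁ :+ y₂₂ :* v₂))))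
    refl (X i i₀) (X i i₁) (X i i₂) (Y i₀ i₀) (Y i₀ i₁) (Y i₀ i₂) (Y i₁ i₀) (Y i₁ i₁) (Y i₁ i₂)
         (Y i₂ i₀) (Y i₂ i₁) (Y i₂ i₂) (v i₀) (v i₁) (v i₂)

  ᵀ-∙ : ∀ A B → (B ∙ A) ᵀ ≈ₘ A ᵀ ∙ B ᵀ
  ᵀ-∙ A B i j = solve 6
    (λ b₀ b₁ b₂ a₀ a₁ a₂ → b₀ :* a₀ :+ (b₁ :* a₁ :+ b₂ :* a₂) := a₀ :* b₀ :+ (a₁ :* b₁ :+ a₂ :* b₂))
    refl (B j i₀) (B j i₁) (B j i₂) (A i₀ i) (A i₁ i) (A i₂ i)

  idM-symmetric : idM F ᵀ ≈ₘ idM F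
  idM-symmetric i₀ i₀ = refl
  idM-symmetric i₀ i₁ = refl
  idM-symmetric i₀ i₂ = refl
  idM-symmetric i₁ i₀ = refl
  idM-symmetric i₁ i₁ = refl
  idM-symmetric i₁ i₂ = refl
  idM-symmetric i₂ i₀ = refl
  idM-symmetric i₂ i₁ = refl
  idM-symmetric i₂ i₂ = refl

  idM-*ᵥ : ∀ w → idM F *ᵥ w ≈ᵥ w
  idM-*ᵥ w i₀ = solve 3 (λ x y z → con 1 :* x :+ (con 0 :* y :+ con 0 :* z) := x) refl (w i₀) (w i₁) (w i₂)
  idM-*ᵥ w i₁ = solve 3 (λ x y z → con 0 :* x :+ (con 1 :* y :+ con 0 :* z) := y) refl (w i₀) (w i₁) (w i₂)
  idM-*ᵥ w i₂ = solve 3 (λ x y z → con 0 :* x :+ (con 0 :* y :+ con 1 :* z) := z) refl (w i₀) (w i₁) (w i₂)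

  *ᵥ-0ᵥ : ∀ A → A *ᵥ 0ᵥ ≈ᵥ 0ᵥ
  *ᵥ-0ᵥ A i = solve 3 (λ a₀ a₁ a₂ → a₀ :* con 0 :+ (a₁ :* con 0 :+ a₂ :* con 0) := con 0)
    refl (A i i₀) (A i i₁) (A i i₂)

  *ᵥ-*ₛ : ∀ A l u → A *ᵥ (l *ₛ u) ≈ᵥ l *ₛ (A *ᵥ u)
  *ᵥ-*ₛ A l u i = solve 7
    (λ a₀ a₁ a₂ l u₀ u₁ u₂ →
      a₀ :* (l :* u₀) :+ (a₁ :* (l :* u₁) :+ a₂ :* (l :* u₂)) := l :* (a₀ :* u₀ :+ (a₁ :* u₁ :+ a₂ :* u₂)))
    refl (A i i₀) (A i i₁) (A i i₂) l (u i₀) (u i₁) (u i₂)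

  act-outer : ∀ A u → act F A (outer u) ≈ₘ outer (A *ᵥ u)
  act-outer A u i j = solve 9
    (λ a₀ a₁ a₂ b₀ b₁ b₂ u₀ u₁ u₂ →
         (a₀ :* (u₀ :* u₀) :+ (a₁ :* (u₁ :* u₀) :+ a₂ :* (u₂ :* u₀))) :* b₀
      :+ ((a₀ :* (u₀ :* u₁) :+ (a₁ :* (u₁ :* u₁) :+ a₂ :* (u₂ :* u₁))) :* b₁
      :+  (a₀ :* (u₀ :* u₂) :+ (a₁ :* (u₁ :* u₂) :+ a₂ :* (u₂ :* u₂))) :* b₂)
      := (a₀ :* u₀ :+ (a₁ :* u₁ :+ a₂ :* u₂)) :* (b₀ :* u₀ :+ (b₁ :* u₁ :+ b₂ :* u₂)))
    refl (A i i₀) (A i i₁) (A i i₂) (A j i₀) (A j i₁) (A j i₂) (u i₀) (u i₁) (u i₂)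

  dot-ᵀ : ∀ B w x → dot (B ᵀ *ᵥ w) x ≈ dot w (B *ᵥ x)
  dot-ᵀ B w x = solve 15
    (λ b₀₀ b₀₁ b₀₂ b₁₀ b₁₁ b₁₂ b₂₀ b₂₁ b₂₂ w₀ w₁ w₂ x₀ x₁ x₂ →
         (b₀₀ :* w₀ :+ (b₁₀ :* w₁ :+ b₂₀ :* w₂)) :* x₀
      :+ ((b₀₁ :* w₀ :+ (b₁₁ :* w₁ :+ b₂₁ :* w₂)) :* x₁
      :+  (b₀₂ :* w₀ :+ (b₁₂ :* w₁ :+ b₂₂ :* w₂)) :* x₂)
      :=   w₀ :* (b₀₀ :* x₀ :+ (b₀₁ :* x₁ :+ b₀₂ :* x₂))
      :+ (w₁ :* (b₁₀ :* x₀ :+ (b₁₁ :* x₁ :+ b₁₂ :* x₂))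
      :+  w₂ :* (b₂₀ :* x₀ :+ (b₂₁ :* x₁ :+ b₂₂ :* x₂))))
    refl (B i₀ i₀) (B i₀ i₁) (B i₀ i₂) (B i₁ i₀) (B i₁ i₁) (B i₁ i₂) (B i₂ i₀) (B i₂ i₁) (B i₂ i₂)
         (w i₀) (w i₁) (w i₂) (x i₀) (x i₁) (x i₂)

  module LeftInverse (A B : Mat F) (B∙A≈I : B ∙ A ≈ₘ idM F) where

    *ᵥ-inverseˡ : ∀ u → B *ᵥ A *ᵥ u ≈ᵥ u
    *ᵥ-inverseˡ u = ≈ᵥ-trans (≈ᵥ-sym (∙-*ᵥ-assoc B A u))
                             (≈ᵥ-trans (*ᵥ-congʳ {B ∙ A} B∙A≈I u) (idM-*ᵥ u))

    *ᵥ-preserves-NonZero : ∀ {u} → NonZero u → NonZero (A *ᵥ u)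
    *ᵥ-preserves-NonZero {u} u≢0 Au≈0 =
      u≢0 (≈ᵥ-trans (≈ᵥ-sym (*ᵥ-inverseˡ u)) (≈ᵥ-trans (*ᵥ-congˡ B Au≈0) (*ᵥ-0ᵥ B)))

  ᵀ-inverseˡ : ∀ A B → B ∙ A ≈ₘ idM F → A ᵀ ∙ B ᵀ ≈ₘ idM F
  ᵀ-inverseˡ A B B∙A≈I = ≈ₘ-trans (≈ₘ-sym (ᵀ-∙ A B)) (≈ₘ-trans (ᵀ-cong {B ∙ A} B∙A≈I) idM-symmetric)

  module Action (A B : Mat F) (B∙A≈I : B ∙ A ≈ₘ idM F) where
    open LeftInverse A B B∙A≈I public
    module Transposed = LeftInverse (B ᵀ) (A ᵀ) (ᵀ-inverseˡ A B B∙A≈I)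

    act-*ᵥ : ∀ N w → act F A N *ᵥ B ᵀ *ᵥ w ≈ᵥ A *ᵥ N *ᵥ w
    act-*ᵥ N w =
      ≈ᵥ-trans (∙-*ᵥ-assoc (A ∙ N) (A ᵀ) (B ᵀ *ᵥ w))
      (≈ᵥ-trans (*ᵥ-congˡ (A ∙ N) (Transposed.*ᵥ-inverseˡ w)) (∙-*ᵥ-assoc A N w))

  CommonPolarPoint : Plane F → Set (c ⊔ ℓ)
  CommonPolarPoint P =
    Σ Vec3 λ w → NonZero w × Σ Vec3 λ u → ∀ M → P M → Σ Carrier λ l → M *ᵥ w ≈ᵥ l *ₛ u

  TangentLineInPlane : Plane F → Set (c ⊔ ℓ)
  TangentLineInPlane P =
    Σ Vec3 λ w → Σ (Mat F) λ N →
      P N × dot w (N *ᵥ w) ≈ 0# × NonZero (N *ᵥ w) × P (outer (N *ᵥ w))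

  SameOrbit-CommonPolarPoint : ∀ {P P′} → SameOrbit F P P′ →
                               CommonPolarPoint P → CommonPolarPoint P′
  SameOrbit-CommonPolarPoint {P} {P′} (A , (B , _ , B∙A≈I) , _ , onto) (w , w≢0 , u , polar) =
    B ᵀ *ᵥ w , Transposed.*ᵥ-preserves-NonZero w≢0 , A *ᵥ u , polar′
    where
    open Action A B B∙A≈I
    polar′ : ∀ N → P′ N → Σ Carrier λ l → N *ᵥ B ᵀ *ᵥ w ≈ᵥ l *ₛ A *ᵥ u
    polar′ N N∈P′ with onto N N∈P′
    ... | M , M∈P , AMAᵀ≈N with polar M M∈P
    ... | l , Mw≈lu = l ,
      ≈ᵥ-trans (*ᵥ-congʳ {N} (≈ₘ-sym AMAᵀ≈N) (B ᵀ *ᵥ w))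
      (≈ᵥ-trans (act-*ᵥ M w) (≈ᵥ-trans (*ᵥ-congˡ A Mw≈lu) (*ᵥ-*ₛ A l u)))

  SameOrbit-TangentLineInPlane : ∀ {P P′} → P′ Respects _≈ₘ_ → SameOrbit F P P′ →
                                 TangentLineInPlane P → TangentLineInPlane P′
  SameOrbit-TangentLineInPlane {P′ = P′} resp (A , (B , _ , B∙A≈I) , into , _)
                               (w , N , N∈P , w∈N , u≢0 , uuᵀ∈P) =
    B ᵀ *ᵥ w , act F A N , into N N∈P , w′∈N′ , u′≢0 , u′u′ᵀ∈P′
    where
    open Action A B B∙A≈I
    u : Vec3
    u = N *ᵥ w
    u′≈Au : act F A N *ᵥ B ᵀ *ᵥ w ≈ᵥ A *ᵥ u
    u′≈Au = act-*ᵥ N w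
    w′∈N′ : dot (B ᵀ *ᵥ w) (act F A N *ᵥ B ᵀ *ᵥ w) ≈ 0#
    w′∈N′ = begin
      dot (B ᵀ *ᵥ w) (act F A N *ᵥ B ᵀ *ᵥ w) ≈⟨ dot-congʳ (B ᵀ *ᵥ w) u′≈Au ⟩
      dot (B ᵀ *ᵥ w) (A *ᵥ u)                ≈⟨ dot-ᵀ B w (A *ᵥ u) ⟩
      dot w (B *ᵥ A *ᵥ u)                    ≈⟨ dot-congʳ w (*ᵥ-inverseˡ u) ⟩
      dot w u                                ≈⟨ w∈N ⟩
      0#                                     ∎
    u′≢0 : NonZero (act F A N *ᵥ B ᵀ *ᵥ w)
    u′≢0 u′≈0 = *ᵥ-preserves-NonZero u≢0 (≈ᵥ-trans (≈ᵥ-sym u′≈Au) u′≈0)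
    u′u′ᵀ∈P′ : P′ (outer (act F A N *ᵥ B ᵀ *ᵥ w))
    u′u′ᵀ∈P′ = resp (≈ₘ-trans (act-outer A u) (outer-cong (≈ᵥ-sym u′≈Au))) (into (outer u) uuᵀ∈P)

  Parallel : Vec3 → Vec3 → Set ℓ
  Parallel x y = ∀ i j → x i * y j ≈ x j * y i

  *ₛ-parallel : ∀ {x y l m u} → x ≈ᵥ l *ₛ u → y ≈ᵥ m *ₛ u → Parallel x y
  *ₛ-parallel {x} {y} {l} {m} {u} x≈lu y≈mu i j = begin
    x i * y j              ≈⟨ *-cong (x≈lu i) (y≈mu j) ⟩
    (l * u i) * (m * u j)  ≈⟨ solve 4 (λ l m a b → (l :* a) :* (m :* b) := (l :* b) :* (m :* a)) refl l m (u i) (u j) ⟩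
    (l * u j) * (m * u i)  ≈⟨ *-cong (x≈lu j) (y≈mu i) ⟨
    x j * y i              ∎

  common-polar⇒parallel : ∀ {P : Plane F} {w u M M′ x y} →
    (∀ N → P N → Σ Carrier λ l → N *ᵥ w ≈ᵥ l *ₛ u) →
    P M → P M′ → M *ᵥ w ≈ᵥ x → M′ *ᵥ w ≈ᵥ y → Parallel x y
  common-polar⇒parallel {M = M} {M′} polar M∈P M′∈P Mw≈x M′w≈y with polar M M∈P | polar M′ M′∈P
  ... | _ , Mw≈lu | _ , M′w≈mu =
    *ₛ-parallel (≈ᵥ-trans (≈ᵥ-sym Mw≈x) Mw≈lu) (≈ᵥ-trans (≈ᵥ-sym M′w≈y) M′w≈mu)

  parallel-polars⇒≈0 : ∀ {δ} w → ¬ δ ≈ 0# →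
    Parallel (vec3 (w i₀) 0# 0#) (vec3 0# (w i₁) (δ * w i₂)) →
    Parallel (vec3 (w i₀) 0# 0#) (vec3 (w i₁) (w i₀ + w i₂) (w i₁)) →
    Parallel (vec3 0# (w i₁) (δ * w i₂)) (vec3 (w i₁) (w i₀ + w i₂) (w i₁)) →
    w ≈ᵥ 0ᵥ
  parallel-polars⇒≈0 {δ} w δ≉0 a∥d a∥j d∥j = λ where
      i₀ → w₀≈0
      i₁ → w₁≈0
      i₂ → w₂≈0
    where
    w₀ w₁ w₂ : Carrier
    w₀ = w i₀
    w₁ = w i₁
    w₂ = w i₂
    w₁≈0 : w₁ ≈ 0#
    w₁≈0 = x*x≈0⇒x≈0 (trans (sym (d∥j i₀ i₁)) (zeroˡ (w₀ + w₂)))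
    w₀w₂≈0 : w₀ * w₂ ≈ 0#
    w₀w₂≈0 = x≉0⇒x*y≈0⇒y≈0 δ≉0 (begin
      δ * (w₀ * w₂)  ≈⟨ solve 3 (λ d a b → d :* (a :* b) := a :* (d :* b)) refl δ w₀ w₂ ⟩
      w₀ * (δ * w₂)  ≈⟨ a∥d i₀ i₂ ⟩
      0# * 0#        ≈⟨ zeroˡ 0# ⟩
      0#             ∎)
    w₀≈0 : w₀ ≈ 0#
    w₀≈0 = x*x≈0⇒x≈0 (begin
      w₀ * w₀              ≈⟨ +-identityʳ (w₀ * w₀) ⟨
      w₀ * w₀ + 0#         ≈⟨ +-congˡ w₀w₂≈0 ⟨
      w₀ * w₀ + w₀ * w₂    ≈⟨ distribˡ w₀ w₀ w₂ ⟨
      w₀ * (w₀ + w₂)       ≈⟨ a∥j i₀ i₁ ⟩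
      0# * w₁              ≈⟨ zeroˡ w₁ ⟩
      0#                   ∎)
    w₂≈0 : w₂ ≈ 0#
    w₂≈0 = x*x≈0⇒x≈0 (x≉0⇒x*y≈0⇒y≈0 δ≉0 (begin
      δ * (w₂ * w₂)          ≈⟨ solve 2 (λ d a → d :* (a :* a) := (d :* a) :* (con 0 :+ a)) refl δ w₂ ⟩
      (δ * w₂) * (0# + w₂)   ≈⟨ *-congˡ (+-congʳ w₀≈0) ⟨
      (δ * w₂) * (w₀ + w₂)   ≈⟨ d∥j i₂ i₁ ⟩
      w₁ * w₁                ≈⟨ x≈0⇒x*y≈0 w₁ w₁≈0 ⟩
      0#                     ∎))

  E₁₁ : Mat F
  E₁₁ = mk F 1# 0# 0# 0# 0# 0# 0# 0# 0#

  E₂₂+_E₃₃ : Carrier → Mat F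
  E₂₂+ δ E₃₃ = mk F 0# 0# 0# 0# 1# 0# 0# 0# δ

  J : Mat F
  J = mk F 0# 1# 0# 1# 0# 1# 0# 1# 0#

  E₁₁-*ᵥ : ∀ w → E₁₁ *ᵥ w ≈ᵥ vec3 (w i₀) 0# 0#
  E₁₁-*ᵥ w i₀ = solve 3 (λ x y z → con 1 :* x :+ (con 0 :* y :+ con 0 :* z) := x) refl (w i₀) (w i₁) (w i₂)
  E₁₁-*ᵥ w i₁ = solve 3 (λ x y z → con 0 :* x :+ (con 0 :* y :+ con 0 :* z) := con 0) refl (w i₀) (w i₁) (w i₂)
  E₁₁-*ᵥ w i₂ = solve 3 (λ x y z → con 0 :* x :+ (con 0 :* y :+ con 0 :* z) := con 0) refl (w i₀) (w i₁) (w i₂)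

  E₂₂+E₃₃-*ᵥ : ∀ δ w → E₂₂+ δ E₃₃ *ᵥ w ≈ᵥ vec3 0# (w i₁) (δ * w i₂)
  E₂₂+E₃₃-*ᵥ δ w i₀ = solve 3 (λ x y z → con 0 :* x :+ (con 0 :* y :+ con 0 :* z) := con 0) refl (w i₀) (w i₁) (w i₂)
  E₂₂+E₃₃-*ᵥ δ w i₁ = solve 3 (λ x y z → con 0 :* x :+ (con 1 :* y :+ con 0 :* z) := y) refl (w i₀) (w i₁) (w i₂)
  E₂₂+E₃₃-*ᵥ δ w i₂ = solve 4 (λ d x y z → con 0 :* x :+ (con 0 :* y :+ d :* z) := d :* z) refl δ (w i₀) (w i₁) (w i₂)

  J-*ᵥ : ∀ w → J *ᵥ w ≈ᵥ vec3 (w i₁) (w i₀ + w i₂) (w i₁)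
  J-*ᵥ w i₀ = solve 3 (λ x y z → con 0 :* x :+ (con 1 :* y :+ con 0 :* z) := y) refl (w i₀) (w i₁) (w i₂)
  J-*ᵥ w i₁ = solve 3 (λ x y z → con 1 :* x :+ (con 0 :* y :+ con 1 :* z) := x :+ z) refl (w i₀) (w i₁) (w i₂)
  J-*ᵥ w i₂ = solve 3 (λ x y z → con 0 :* x :+ (con 1 :* y :+ con 0 :* z) := y) refl (w i₀) (w i₁) (w i₂)

  ¬CommonPolarPoint : ∀ {P : Plane F} {δ} → ¬ δ ≈ 0# →
    P E₁₁ → P (E₂₂+ δ E₃₃) → P J → ¬ CommonPolarPoint P
  ¬CommonPolarPoint {P} {δ} δ≉0 E₁₁∈P E∈P J∈P (w , w≢0 , _ , polar) =
    w≢0 (parallel-polars⇒≈0 w δ≉0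
      (parallel E₁₁∈P E∈P (E₁₁-*ᵥ w) (E₂₂+E₃₃-*ᵥ δ w))
      (parallel E₁₁∈P J∈P (E₁₁-*ᵥ w) (J-*ᵥ w))
      (parallel E∈P J∈P (E₂₂+E₃₃-*ᵥ δ w) (J-*ᵥ w)))
    where
    parallel : ∀ {M M′ x y} → P M → P M′ → M *ᵥ w ≈ᵥ x → M′ *ᵥ w ≈ᵥ y → Parallel x y
    parallel = common-polar⇒parallel {P = P} {w = w} polar

  mk-cong₃₃ : ∀ {a b c′ d e f g h k k′} → k ≈ k′ → mk F a b c′ d e f g h k ≈ₘ mk F a b c′ d e f g h k′
  mk-cong₃₃ k≈k′ i₀ i₀ = refl
  mk-cong₃₃ k≈k′ i₀ i₁ = refl
  mk-cong₃₃ k≈k′ i₀ i₂ = refl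
  mk-cong₃₃ k≈k′ i₁ i₀ = refl
  mk-cong₃₃ k≈k′ i₁ i₁ = refl
  mk-cong₃₃ k≈k′ i₁ i₂ = refl
  mk-cong₃₃ k≈k′ i₂ i₀ = refl
  mk-cong₃₃ k≈k′ i₂ i₁ = refl
  mk-cong₃₃ k≈k′ i₂ i₂ = k≈k′

  Π₁₂-¬CommonPolarPoint : ¬ CommonPolarPoint (Π₁₂ F)
  Π₁₂-¬CommonPolarPoint =
    ¬CommonPolarPoint 1≉0 (1# , 0# , 0# , ≈ₘ-refl) (0# , 0# , 1# , ≈ₘ-refl) (0# , 1# , 0# , ≈ₘ-refl)

  Π₁₃-¬CommonPolarPoint : ∀ {ε} → ¬ IsSquare F ε → ¬ CommonPolarPoint (Π₁₃ F ε)
  Π₁₃-¬CommonPolarPoint {ε} ε-nonsquare =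
    ¬CommonPolarPoint (nonsquare⇒≉0 ε-nonsquare)
      (1# , 0# , 0# , mk-cong₃₃ (sym (zeroʳ ε)))
      (0# , 0# , 1# , mk-cong₃₃ (sym (*-identityʳ ε)))
      (0# , 1# , 0# , mk-cong₃₃ (sym (zeroʳ ε)))

  Π₆-CommonPolarPoint : ∀ ε → CommonPolarPoint (Π₆ F ε)
  Π₆-CommonPolarPoint ε = e₃ , (λ e₃≈0 → 1≉0 (e₃≈0 i₂)) , e₃ , polar
    where
    e₃ : Vec3
    e₃ = vec3 0# 0# 1#
    polar : ∀ M → Π₆ F ε M → Σ Carrier λ l → M *ᵥ e₃ ≈ᵥ l *ₛ e₃
    polar M (α , β , γ , M≈) = γ , ≈ᵥ-trans (*ᵥ-congʳ {M} M≈ e₃) image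
      where
      image : mk F α β 0# β (ε * α) 0# 0# 0# γ *ᵥ e₃ ≈ᵥ γ *ₛ e₃
      image i₀ = solve 3 (λ a b g → a :* con 0 :+ (b :* con 0 :+ con 0 :* con 1) := g :* con 0) refl α β γ
      image i₁ = solve 4 (λ e a b g → b :* con 0 :+ ((e :* a) :* con 0 :+ con 0 :* con 1) := g :* con 0) refl ε α β γ
      image i₂ = solve 1 (λ g → con 0 :* con 0 :+ (con 0 :* con 0 :+ g :* con 1) := g :* con 1) refl γ

  Π₁₂-TangentLineInPlane : TangentLineInPlane (Π₁₂ F)
  Π₁₂-TangentLineInPlane =
    w , N , (0# , 1# , 1# , ≈ₘ-refl) , w∈N , u≢0 , (u i₀ * u i₀ , 0# , 0# , uuᵀ≈)
    where
    w : Vec3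
    w = vec3 0# 1# (- 1#)
    N : Mat F
    N = mk F 0# 1# 0# 1# 1# 1# 0# 1# 1#
    u : Vec3
    u = N *ᵥ w
    u₀≈1 : u i₀ ≈ 1#
    u₀≈1 = solve 1 (λ m → con 0 :* con 0 :+ (con 1 :* con 1 :+ con 0 :* m) := con 1) refl (- 1#)
    u₁≈0 : u i₁ ≈ 0#
    u₁≈0 = trans (solve 1 (λ m → con 1 :* con 0 :+ (con 1 :* con 1 :+ con 1 :* m) := con 1 :+ m) refl (- 1#))
                 (-‿inverseʳ 1#)
    u₂≈0 : u i₂ ≈ 0#
    u₂≈0 = trans (solve 1 (λ m → con 0 :* con 0 :+ (con 1 :* con 1 :+ con 1 :* m) := con 1 :+ m) refl (- 1#))
                 (-‿inverseʳ 1#)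
    w∈N : dot w u ≈ 0#
    w∈N = trans (sum3-cong (zeroˡ (u i₀)) (y≈0⇒x*y≈0 1# u₁≈0) (y≈0⇒x*y≈0 (- 1#) u₂≈0))
                (trans (+-identityˡ _) (+-identityˡ 0#))
    u≢0 : NonZero u
    u≢0 u≈0 = 1≉0 (trans (sym u₀≈1) (u≈0 i₀))
    uuᵀ≈ : outer u ≈ₘ mk F (u i₀ * u i₀) 0# 0# 0# 0# 0# 0# 0# 0#
    uuᵀ≈ i₀ i₀ = refl
    uuᵀ≈ i₀ i₁ = y≈0⇒x*y≈0 (u i₀) u₁≈0
    uuᵀ≈ i₀ i₂ = y≈0⇒x*y≈0 (u i₀) u₂≈0
    uuᵀ≈ i₁ i₀ = x≈0⇒x*y≈0 (u i₀) u₁≈0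
    uuᵀ≈ i₁ i₁ = x≈0⇒x*y≈0 (u i₁) u₁≈0
    uuᵀ≈ i₁ i₂ = x≈0⇒x*y≈0 (u i₂) u₁≈0
    uuᵀ≈ i₂ i₀ = x≈0⇒x*y≈0 (u i₀) u₂≈0
    uuᵀ≈ i₂ i₁ = x≈0⇒x*y≈0 (u i₁) u₂≈0
    uuᵀ≈ i₂ i₂ = x≈0⇒x*y≈0 (u i₂) u₂≈0

  Π₁₃-respects : ∀ ε → Π₁₃ F ε Respects _≈ₘ_
  Π₁₃-respects ε M≈M′ (α , β , γ , M≈) = α , β , γ , ≈ₘ-trans (≈ₘ-sym M≈M′) M≈

  Π₁₃-member-*ᵥ : ∀ ε α β γ w → w i₀ ≈ 0# →
    mk F α β 0# β γ β 0# β (ε * γ) *ᵥ w ≈ᵥ vec3 (β * w i₁) (γ * w i₁ + β * w i₂) (β * w i₁ + (ε * γ) * w i₂)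
  Π₁₃-member-*ᵥ ε α β γ w w₀≈0 i₀ = trans (+-congʳ (y≈0⇒x*y≈0 α w₀≈0))
    (solve 3 (λ b x y → con 0 :+ (b :* x :+ con 0 :* y) := b :* x) refl β (w i₁) (w i₂))
  Π₁₃-member-*ᵥ ε α β γ w w₀≈0 i₁ = trans (+-congʳ (y≈0⇒x*y≈0 β w₀≈0)) (+-identityˡ _)
  Π₁₃-member-*ᵥ ε α β γ w w₀≈0 i₂ = trans (+-congʳ (zeroˡ (w i₀))) (+-identityˡ _)

  Π₁₃-¬TangentLineInPlane : ∀ {ε} → ¬ IsSquare F ε → ¬ TangentLineInPlane (Π₁₃ F ε)
  Π₁₃-¬TangentLineInPlane {ε} ε-nonsquare (w , N , (α , β , γ , N≈) , w∈N , u≢0 , (_ , _ , _ , uuᵀ≈)) =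
    u≢0 λ where
      i₀ → u₀≈0
      i₁ → u₁≈0
      i₂ → u₂≈0
    where
    u : Vec3
    u = N *ᵥ w
    u₂²≈εu₁² : u i₂ * u i₂ ≈ ε * (u i₁ * u i₁)
    u₂²≈εu₁² = trans (uuᵀ≈ i₂ i₂) (*-congˡ (sym (uuᵀ≈ i₁ i₁)))
    u₁≈0 : u i₁ ≈ 0#
    u₁≈0 = x*x≈ε*y*y⇒y≈0 ε-nonsquare u₂²≈εu₁²
    u₂≈0 : u i₂ ≈ 0#
    u₂≈0 = x*x≈ε*y*y⇒x≈0 ε-nonsquare u₂²≈εu₁²
    w₀u₀≈0 : w i₀ * u i₀ ≈ 0#
    w₀u₀≈0 = begin
      w i₀ * u i₀
        ≈⟨ solve 3 (λ a x y → a := a :+ (x :* con 0 :+ y :* con 0)) refl (w i₀ * u i₀) (w i₁) (w i₂) ⟩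
      w i₀ * u i₀ + (w i₁ * 0# + w i₂ * 0#) ≈⟨ +-congˡ (+-cong (*-congˡ u₁≈0) (*-congˡ u₂≈0)) ⟨
      dot w u                               ≈⟨ w∈N ⟩
      0#                                    ∎
    u₀≈0 : u i₀ ≈ 0#
    u₀≈0 with x*y≈0⇒x≈0⊎y≈0 (w i₀) (u i₀) w₀u₀≈0
    ... | inj₂ u₀≈0 = u₀≈0
    ... | inj₁ w₀≈0 = trans (Nw i₀)
      (nonsquare-kernel ε-nonsquare (trans (sym (Nw i₁)) u₁≈0) (trans (sym (Nw i₂)) u₂≈0))
      where
      Nw : u ≈ᵥ vec3 (β * w i₁) (γ * w i₁ + β * w i₂) (β * w i₁ + (ε * γ) * w i₂)
      Nw = ≈ᵥ-trans (*ᵥ-congʳ {N} N≈ w) (Π₁₃-member-*ᵥ ε α β γ w w₀≈0)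

lemma7p10 : {c ℓ : Level} (F : FiniteOddField c ℓ) (ε : FiniteOddField.Carrier F) →
            ¬ IsSquare F ε →
            ¬ SameOrbit F (Π₆ F ε) (Π₁₂ F) ×
            ¬ SameOrbit F (Π₆ F ε) (Π₁₃ F ε) ×
            ¬ SameOrbit F (Π₁₂ F) (Π₁₃ F ε)
lemma7p10 F ε ε-nonsquare =
  (λ Σ₆~Σ₁₂ → Π₁₂-¬CommonPolarPoint F (SameOrbit-CommonPolarPoint F Σ₆~Σ₁₂ (Π₆-CommonPolarPoint F ε))) ,
  (λ Σ₆~Σ₁₃ → Π₁₃-¬CommonPolarPoint F ε-nonsquare
                (SameOrbit-CommonPolarPoint F Σ₆~Σ₁₃ (Π₆-CommonPolarPoint F ε))) ,
  (λ Σ₁₂~Σ₁₃ → Π₁₃-¬TangentLineInPlane F ε-nonsquare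
                 (SameOrbit-TangentLineInPlane F (Π₁₃-respects F ε) Σ₁₂~Σ₁₃ (Π₁₂-TangentLineInPlane F)))
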